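{- Let $n\geq 3$ and let $1,2,\ldots,s_{\delta(n)},s_{\delta(n)+1}=n$ be an addition chain producing $n$ of length $\delta(n)$, with associated generators $2=a_2+r_2$, $s_3=a_3+r_3,\ldots,s_{\delta(n)}=a_{\delta(n)}+r_{\delta(n)},\ s_{\delta(n)+1}=a_{\delta(n)+1}+r_{\delta(n)+1}=n$, where $a_2=r_2=1$ and $a_{i+1}=a_i+r_i$ for $2\leq i\leq\delta(n)$. Then \[\sum_{j=2}^{\delta(n)+1} s_j=2(n-1)+(\delta(n)-1)+a_{\delta(n)}-r_{\delta(n)+1}+\int_{2}^{\delta(n)-1}\sum_{2\leq j\leq t} r_j\,dt.\]
   Context: An addition chain of length $k-1$ producing $n$ is a sequence $1=s_1,2=s_2,\ldots,s_{k-1},s_k=n$ in which each term $s_j$ ($j\geq 3$) is the sum of two earlier terms. In this paper each term is written via a partition $s_i=a_i+r_i$ ($2\leq i\leq k$), called the $i$-th generator, with $2=1+1$ (i.e. $a_2=r_2=1$) and $a_{i+1}=a_i+r_i$; $a_i$ is the determiner and $r_i$ the regulator of the $i$-th generator. Here $k-1=\delta(n)$. The integrand $t\mapsto\sum_{2\leq j\leq t}r_j$ is the step function of the real variable $t$ summing the regulators with integer index $j$ satisfying $2\leq j\leq t$. -}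

module Defs where

open import Data.Nat using (ℕ; zero; suc; _+_; _∸_; _≤_; _<_; _≤?_)
open import Data.List using (List; applyUpTo; map)
open import Data.Nat.ListAction using (sum)
open import Data.Integer as ℤ using (ℤ)
open import Data.Product using (Σ; ∃; _×_; _,_)
open import Relation.Nullary using (yes; no)
open import Relation.Binary.PropositionalEquality using (_≡_)

sumHalf : (ℕ → ℕ) → ℕ → ℕ → ℕ
sumHalf f a b = sum (map f (applyUpTo (λ m → a + m) (b ∸ a)))

sumRange : (ℕ → ℕ) → ℕ → ℕ → ℕ
sumRange f lo hi = sumHalf f lo (suc hi)

-- the step function t ↦ Σ_{2 ≤ j ≤ t} r j  (its value on [m, m+1) is its value at m)
stepSum : (ℕ → ℕ) → ℕ → ℕ
stepSum r t = sumRange r 2 t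

-- ∫_a^b g(⌊t⌋) dt for integer bounds a, b (oriented integral, ℤ-valued):
-- Σ_{a ≤ m < b} g m if a ≤ b, and - Σ_{b ≤ m < a} g m otherwise.
stepIntegral : (ℕ → ℕ) → ℕ → ℕ → ℤ
stepIntegral g a b with a ≤? b
... | yes _ = ℤ.+ sumHalf g a b
... | no  _ = ℤ.- (ℤ.+ sumHalf g b a)

IsAdditionChain : (s : ℕ → ℕ) → (k n : ℕ) → Set
IsAdditionChain s k n =
  (2 ≤ k) × (s 1 ≡ 1) × (s 2 ≡ 2) × (s k ≡ n) ×
  (∀ j → 3 ≤ j → j ≤ k →
     ∃ λ p → ∃ λ q → (1 ≤ p) × (p < j) × (1 ≤ q) × (q < j) × (s j ≡ s p + s q))

AreGenerators : (s a r : ℕ → ℕ) → (k : ℕ) → Set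
AreGenerators s a r k =
  (a 2 ≡ 1) × (r 2 ≡ 1) ×
  (∀ i → 2 ≤ i → i ≤ k → s i ≡ a i + r i) ×
  (∀ i → 2 ≤ i → i < k → a (suc i) ≡ a i + r i)

module Submission where

-- Write R t = Σ_{2 ≤ j ≤ t} r j for the step function
-- (stepSum r).  Since a 2 = 1 and a (i+1) = a i + r i, every determiner
-- is a (i+1) = 1 + R i, and every term before the last is
-- s j = a j + r j = a (j+1) = 1 + R j (2 ≤ j ≤ δ), while n = 1 + R δ + r (δ+1).
-- Hence Σ_{j=2}^{δ+1} s j = (δ - 1) + Σ_{2 ≤ j ≤ δ} R j + n, and by additivity
-- of the oriented step integral Σ_{2 ≤ j ≤ δ} R j = ∫_2^{δ-1} R + R (δ-1) + R δ.
-- Substituting R (δ-1) = a δ - 1 and R δ = n - 1 - r (δ+1) gives the formula.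

open import Defs
open import Data.Nat using (ℕ; suc; _≤_; _∸_)
open import Data.Integer using (ℤ; +_; _+_; _-_; _*_)
open import Relation.Binary.PropositionalEquality using (_≡_)

open import Data.Nat as ℕ using (zero; _<_; s≤s; z≤n)
import Data.Nat.Properties as ℕP
import Data.Integer as ℤ
import Data.Integer.Properties as ℤP
open import Algebra.Properties.CommutativeSemigroup ℕP.+-commutativeSemigroup
  using (x∙yz≈y∙xz)
import Data.Integer.Tactic.RingSolver as ℤSolver
open import Data.List using (List; applyUpTo; map; [_]; _∷ʳ_; _++_)
open import Data.List.Properties using (applyUpTo-∷ʳ; map-++)
open import Data.Nat.ListAction using (sum)
open import Data.Nat.ListAction.Properties using (sum-++)
open import Data.Product using (_,_; proj₁; proj₂)
open import Data.Empty using (⊥-elim)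
open import Function using (_∘_)
open import Relation.Binary.PropositionalEquality
  using (refl; sym; trans; cong; cong₂; subst; module ≡-Reasoning)

sumHalf-snoc : ∀ (f : ℕ → ℕ) {a b} → a ≤ b →
               sumHalf f a (suc b) ≡ sumHalf f a b ℕ.+ f b
sumHalf-snoc f {a} {b} a≤b = begin
    sum (map f (applyUpTo (a ℕ.+_) (suc b ∸ a)))
  ≡⟨ cong (λ m → sum (map f (applyUpTo (a ℕ.+_) m))) (ℕP.+-∸-assoc 1 a≤b) ⟩
    sum (map f (applyUpTo (a ℕ.+_) (suc (b ∸ a))))
  ≡⟨ cong (sum ∘ map f) (sym (applyUpTo-∷ʳ (a ℕ.+_) (b ∸ a))) ⟩
    sum (map f (indices ∷ʳ (a ℕ.+ (b ∸ a))))
  ≡⟨ cong sum (map-++ f indices [ a ℕ.+ (b ∸ a) ]) ⟩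
    sum (map f indices ++ [ f (a ℕ.+ (b ∸ a)) ])
  ≡⟨ sum-++ (map f indices) [ f (a ℕ.+ (b ∸ a)) ] ⟩
    sumHalf f a b ℕ.+ (f (a ℕ.+ (b ∸ a)) ℕ.+ 0)
  ≡⟨ cong (sumHalf f a b ℕ.+_) (trans (ℕP.+-identityʳ _) (cong f (ℕP.m+[n∸m]≡n a≤b))) ⟩
    sumHalf f a b ℕ.+ f b ∎
  where
  open ≡-Reasoning
  indices : List ℕ
  indices = applyUpTo (a ℕ.+_) (b ∸ a)

sum-applyUpTo-cong : ∀ {f g : ℕ → ℕ} (h : ℕ → ℕ) m →
                     (∀ i → i < m → f (h i) ≡ g (h i)) →
                     sum (map f (applyUpTo h m)) ≡ sum (map g (applyUpTo h m))
sum-applyUpTo-cong h zero    eq = refl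
sum-applyUpTo-cong h (suc m) eq =
  cong₂ ℕ._+_ (eq 0 (s≤s z≤n))
              (sum-applyUpTo-cong (h ∘ suc) m (λ i i<m → eq (suc i) (s≤s i<m)))

sumHalf-cong : ∀ {f g : ℕ → ℕ} a b → (∀ j → a ≤ j → j < b → f j ≡ g j) →
               sumHalf f a b ≡ sumHalf g a b
sumHalf-cong {f} {g} a b eq = sum-applyUpTo-cong (a ℕ.+_) (b ∸ a) inRange
  where
  inRange : ∀ i → i < b ∸ a → f (a ℕ.+ i) ≡ g (a ℕ.+ i)
  inRange i i<b∸a = eq (a ℕ.+ i) (ℕP.m≤m+n a i) (begin-strict
      a ℕ.+ i         <⟨ ℕP.+-monoʳ-< a i<b∸a ⟩
      a ℕ.+ (b ∸ a)   ≡⟨ ℕP.m+[n∸m]≡n a≤b ⟩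
      b               ∎)
    where
    open ℕP.≤-Reasoning
    a≤b : a ≤ b
    a≤b = ℕP.<⇒≤ (ℕP.m∸n≢0⇒n<m (λ b∸a≡0 → ℕP.n≮0 (subst (i <_) b∸a≡0 i<b∸a)))

sum-applyUpTo-suc : ∀ (f h : ℕ → ℕ) m →
                    sum (map (suc ∘ f) (applyUpTo h m)) ≡ m ℕ.+ sum (map f (applyUpTo h m))
sum-applyUpTo-suc f h zero    = refl
sum-applyUpTo-suc f h (suc m) = begin
    suc (f (h 0)) ℕ.+ sum (map (suc ∘ f) (applyUpTo (h ∘ suc) m))
  ≡⟨ cong (suc (f (h 0)) ℕ.+_) (sum-applyUpTo-suc f (h ∘ suc) m) ⟩
    suc (f (h 0)) ℕ.+ (m ℕ.+ sum (map f (applyUpTo (h ∘ suc) m)))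
  ≡⟨ cong suc (x∙yz≈y∙xz (f (h 0)) m _) ⟩
    suc m ℕ.+ (f (h 0) ℕ.+ sum (map f (applyUpTo (h ∘ suc) m))) ∎
  where open ≡-Reasoning

sumHalf-suc : ∀ (f : ℕ → ℕ) a b → sumHalf (suc ∘ f) a b ≡ (b ∸ a) ℕ.+ sumHalf f a b
sumHalf-suc f a b = sum-applyUpTo-suc f (a ℕ.+_) (b ∸ a)

-- Additivity of the oriented step integral:  for b ≥ 1,
-- Σ_{2 ≤ m ≤ b+1} g m = ∫_2^b g + g b + g (b+1).  For b = 1 the integral runs
-- backwards and equals -g 1, which the extra term g 1 cancels.
stepIntegral-split : ∀ (g : ℕ → ℕ) d →
  + sumHalf g 2 (3 ℕ.+ d) ≡ stepIntegral g 2 (suc d) + + g (suc d) + + g (2 ℕ.+ d)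
stepIntegral-split g zero = begin
    + (g 2 ℕ.+ 0)                        ≡⟨ cong +_ (ℕP.+-identityʳ (g 2)) ⟩
    + g 2                                ≡⟨ cancel (+ g 1) (+ g 2) ⟩
    ℤ.- + g 1 + + g 1 + + g 2            ≡⟨ cong (λ x → ℤ.- + x + + g 1 + + g 2) (ℕP.+-identityʳ (g 1)) ⟨
    ℤ.- + (g 1 ℕ.+ 0) + + g 1 + + g 2    ∎
  where
  open ≡-Reasoning
  cancel : ∀ (u v : ℤ) → v ≡ ℤ.- u + u + v
  cancel = ℤSolver.solve-∀
stepIntegral-split g (suc e) = begin
    + sumHalf g 2 (4 ℕ.+ e)
  ≡⟨ cong +_ (sumHalf-snoc g (s≤s (s≤s z≤n))) ⟩
    + (sumHalf g 2 (3 ℕ.+ e) ℕ.+ g (3 ℕ.+ e))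
  ≡⟨ cong (λ x → + (x ℕ.+ g (3 ℕ.+ e))) (sumHalf-snoc g (s≤s (s≤s z≤n))) ⟩
    + (sumHalf g 2 (2 ℕ.+ e) ℕ.+ g (2 ℕ.+ e) ℕ.+ g (3 ℕ.+ e))
  ≡⟨ ℤP.pos-+ (sumHalf g 2 (2 ℕ.+ e) ℕ.+ g (2 ℕ.+ e)) (g (3 ℕ.+ e)) ⟩
    + (sumHalf g 2 (2 ℕ.+ e) ℕ.+ g (2 ℕ.+ e)) + + g (3 ℕ.+ e)
  ≡⟨ cong (_+ + g (3 ℕ.+ e)) (ℤP.pos-+ (sumHalf g 2 (2 ℕ.+ e)) (g (2 ℕ.+ e))) ⟩
    + sumHalf g 2 (2 ℕ.+ e) + + g (2 ℕ.+ e) + + g (3 ℕ.+ e) ∎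
  where open ≡-Reasoning

module Generators (s a r : ℕ → ℕ) (k : ℕ) (gen : AreGenerators s a r k) where

  private
    a₂≡1 : a 2 ≡ 1
    a₂≡1 = proj₁ gen
    s≡a+r : ∀ i → 2 ≤ i → i ≤ k → s i ≡ a i ℕ.+ r i
    s≡a+r = proj₁ (proj₂ (proj₂ gen))
    a-step : ∀ i → 2 ≤ i → i < k → a (suc i) ≡ a i ℕ.+ r i
    a-step = proj₂ (proj₂ (proj₂ gen))

  determiner-closed-form : ∀ m → 2 ℕ.+ m ≤ k → a (2 ℕ.+ m) ≡ suc (stepSum r (suc m))
  determiner-closed-form zero    _      = a₂≡1
  determiner-closed-form (suc m) m+3≤k = begin
      a (3 ℕ.+ m)                              ≡⟨ a-step (2 ℕ.+ m) (s≤s (s≤s z≤n)) m+3≤k ⟩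
      a (2 ℕ.+ m) ℕ.+ r (2 ℕ.+ m)              ≡⟨ cong (ℕ._+ r (2 ℕ.+ m)) previous ⟩
      suc (stepSum r (suc m) ℕ.+ r (2 ℕ.+ m))  ≡⟨ cong suc (sumHalf-snoc r (s≤s (s≤s z≤n))) ⟨
      suc (stepSum r (2 ℕ.+ m))                ∎
    where
    open ≡-Reasoning
    previous : a (2 ℕ.+ m) ≡ suc (stepSum r (suc m))
    previous = determiner-closed-form m (ℕP.<⇒≤ m+3≤k)

  term-value : ∀ m → 2 ℕ.+ m ≤ k → s (2 ℕ.+ m) ≡ suc (stepSum r (suc m) ℕ.+ r (2 ℕ.+ m))
  term-value m m+2≤k = trans (s≡a+r (2 ℕ.+ m) (s≤s (s≤s z≤n)) m+2≤k)
                             (cong (ℕ._+ r (2 ℕ.+ m)) (determiner-closed-form m m+2≤k))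

  term-closed-form : ∀ i → 2 ≤ i → i ≤ k → s i ≡ suc (stepSum r i)
  term-closed-form (suc (suc m)) (s≤s (s≤s z≤n)) i≤k =
    trans (term-value m i≤k) (cong suc (sym (sumHalf-snoc r {2} {2 ℕ.+ m} (s≤s (s≤s z≤n)))))

  sum-of-terms : 2 ≤ k → sumRange s 2 k ≡ (k ∸ 2) ℕ.+ sumHalf (stepSum r) 2 k ℕ.+ s k
  sum-of-terms 2≤k = begin
      sumHalf s 2 (suc k)                             ≡⟨ sumHalf-snoc s 2≤k ⟩
      sumHalf s 2 k ℕ.+ s k                           ≡⟨ cong (ℕ._+ s k) interior ⟩
      sumHalf (suc ∘ stepSum r) 2 k ℕ.+ s k           ≡⟨ cong (ℕ._+ s k) (sumHalf-suc (stepSum r) 2 k) ⟩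
      (k ∸ 2) ℕ.+ sumHalf (stepSum r) 2 k ℕ.+ s k     ∎
    where
    open ≡-Reasoning
    interior : sumHalf s 2 k ≡ sumHalf (suc ∘ stepSum r) 2 k
    interior = sumHalf-cong 2 k (λ j 2≤j j<k → term-closed-form j 2≤j (ℕP.<⇒≤ j<k))

-- The chain sum in ℤ, the integral made explicit (here δ = d + 2 and k = δ + 1):
-- Σ_{2 ≤ j ≤ k} s j = (δ - 1) + (∫_2^{δ-1} R + R (δ-1) + R δ) + s k.
chain-sum-via-integral : ∀ (s a r : ℕ → ℕ) d → AreGenerators s a r (3 ℕ.+ d) →
  + sumRange s 2 (3 ℕ.+ d)
    ≡ (+ (2 ℕ.+ d) - + 1)
      + (stepIntegral (stepSum r) 2 (suc d) + + stepSum r (suc d) + + stepSum r (2 ℕ.+ d))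
      + + s (3 ℕ.+ d)
chain-sum-via-integral s a r d gen = begin
    + sumRange s 2 (3 ℕ.+ d)
  ≡⟨ cong +_ (Generators.sum-of-terms s a r (3 ℕ.+ d) gen (s≤s (s≤s z≤n))) ⟩
    + (suc d ℕ.+ sumHalf R 2 (3 ℕ.+ d) ℕ.+ s (3 ℕ.+ d))
  ≡⟨ ℤP.pos-+ (suc d ℕ.+ sumHalf R 2 (3 ℕ.+ d)) (s (3 ℕ.+ d)) ⟩
    + (suc d ℕ.+ sumHalf R 2 (3 ℕ.+ d)) + + s (3 ℕ.+ d)
  ≡⟨ cong (_+ + s (3 ℕ.+ d)) (ℤP.pos-+ (suc d) (sumHalf R 2 (3 ℕ.+ d))) ⟩
    + suc d + + sumHalf R 2 (3 ℕ.+ d) + + s (3 ℕ.+ d)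
  ≡⟨ cong (λ y → + suc d + y + + s (3 ℕ.+ d)) (stepIntegral-split R d) ⟩
    + suc d + (stepIntegral R 2 (suc d) + + R (suc d) + + R (2 ℕ.+ d)) + + s (3 ℕ.+ d) ∎
  where
  open ≡-Reasoning
  R : ℕ → ℕ
  R = stepSum r

closing-identity : ∀ (δ I R₁ R₂ ρ : ℤ) {x n N A : ℤ} →
  x ≡ (δ - + 1) + (I + R₁ + R₂) + n → n ≡ + 1 + (R₂ + ρ) → N ≡ R₂ + ρ → A ≡ + 1 + R₁ →
  x ≡ + 2 * N + (δ - + 1) + A - ρ + I
closing-identity δ I R₁ R₂ ρ refl refl refl refl = identity δ I R₁ R₂ ρ
  where
  identity : ∀ δ I R₁ R₂ ρ →
    (δ - + 1) + (I + R₁ + R₂) + (+ 1 + (R₂ + ρ)) ≡ + 2 * (R₂ + ρ) + (δ - + 1) + (+ 1 + R₁) - ρ + I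
  identity = ℤSolver.solve-∀

theorem2p11 : (n δ : ℕ) (s a r : ℕ → ℕ) →
    3 ≤ n →
    IsAdditionChain s (suc δ) n →
    AreGenerators s a r (suc δ) →
    + sumRange s 2 (suc δ)
      ≡ (+ 2) * (+ (n ∸ 1)) + (+ δ - + 1) + + a δ - + r (suc δ)
        + stepIntegral (stepSum r) 2 (δ ∸ 1)
theorem2p11 n zero s a r _ (s≤s () , _) _
theorem2p11 n (suc zero) s a r n≥3 (_ , _ , s₂≡2 , s₂≡n , _) _ =
  ⊥-elim (ℕP.<-irrefl (trans (sym s₂≡2) s₂≡n) n≥3)
theorem2p11 n (suc (suc d)) s a r _ (_ , _ , _ , sₖ≡n , _) gen =
  closing-identity (+ suc (suc d)) (stepIntegral R 2 (suc d)) (+ R (suc d)) (+ R (2 ℕ.+ d))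
                   (+ r (3 ℕ.+ d))
                   (chain-sum-via-integral s a r d gen) last-term n-1-value a-value
  where
  open Generators s a r (3 ℕ.+ d) gen
  R : ℕ → ℕ
  R = stepSum r

  last-generator : s (3 ℕ.+ d) ≡ suc (R (2 ℕ.+ d) ℕ.+ r (3 ℕ.+ d))
  last-generator = term-value (suc d) ℕP.≤-refl

  R+ρ : + (R (2 ℕ.+ d) ℕ.+ r (3 ℕ.+ d)) ≡ + R (2 ℕ.+ d) + + r (3 ℕ.+ d)
  R+ρ = ℤP.pos-+ (R (2 ℕ.+ d)) (r (3 ℕ.+ d))

  last-term : + s (3 ℕ.+ d) ≡ + 1 + (+ R (2 ℕ.+ d) + + r (3 ℕ.+ d))
  last-term = trans (cong +_ last-generator) (trans (ℤP.pos-+ 1 _) (cong (λ y → + 1 + y) R+ρ))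

  n-1-value : + (n ∸ 1) ≡ + R (2 ℕ.+ d) + + r (3 ℕ.+ d)
  n-1-value = trans (cong (λ m → + (m ∸ 1)) (trans (sym sₖ≡n) last-generator)) R+ρ

  a-value : + a (2 ℕ.+ d) ≡ + 1 + + R (suc d)
  a-value = trans (cong +_ (determiner-closed-form d (ℕP.n≤1+n _)))
                  (ℤP.pos-+ 1 _)
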